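{- Let $(W_r)_{r\in\mathbb{Z}}$ be a generalized Tribonacci sequence. For every integer $r$, \[ \begin{split} &11844W_{r}^3+3W_{r-19}^3+W_{r-17}^3+458556W_{r-6}^3\\ &\quad+135548W_{r-4}^3-442179W_{r-3}^3-120204W_{r-2}^3-43569W_{r-1}^3=0. \end{split} \]
   Context: Let $W_0,W_1,W_2$ be arbitrary integers, not all zero. The generalized Tribonacci numbers $(W_r)_{r\in\mathbb{Z}}$ are defined by $W_r=W_{r-1}+W_{r-2}+W_{r-3}$ for $r\ge 3$, and extended to negative indices by $W_{ -r}=W_{ -r+3}-W_{ -r+2}-W_{ -r+1}$ (so the recurrence holds for all $r\in\mathbb{Z}$). -}

module Defs where

open import Data.Integer using (ℤ; _+_; _-_; +_)
open import Data.Product using (_×_)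
open import Relation.Binary.PropositionalEquality using (_≡_)
open import Relation.Nullary using (¬_)

-- A generalized Tribonacci sequence indexed by ℤ: the recurrence
-- W r = W (r-1) + W (r-2) + W (r-3) holds for every integer r
-- (equivalent to the forward recurrence for r ≥ 3 plus the stated
-- backward extension), and the initial values W 0, W 1, W 2 are not all zero.
record IsGenTribonacci (W : ℤ → ℤ) : Set where
  field
    recurrence : ∀ (r : ℤ) → W r ≡ W (r - + 1) + W (r - + 2) + W (r - + 3)
    nonzero    : ¬ (W (+ 0) ≡ + 0 × W (+ 1) ≡ + 0 × W (+ 2) ≡ + 0)

module Submission where

open import Defs
open import Data.Integer using (ℤ; _+_; _-_; _*_; +_; -_)
open import Data.Integer.Properties using (+-assoc; +-identityˡ; +-identityʳ; *-zeroʳ)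
open import Data.Integer.Tactic.RingSolver using (solve-∀)
open import Data.List using (List; []; _∷_; map)
open import Data.List.Properties using (map-cong; map-∘)
open import Data.Nat using (ℕ; suc)
open import Data.Product using (_×_; _,_; map₂)
open import Data.Vec using (Vec; []; _∷_; replicate; zipWith)
import Data.Vec as Vec
open import Function using (_∘_)
open import Relation.Binary.PropositionalEquality
  using (_≡_; refl; sym; trans; cong; cong₂)
open Relation.Binary.PropositionalEquality.≡-Reasoning

-- With x n = W (r − 19 + n), every x n is an integral linear form in a = x 0, b = x 1, c = x 2,
-- whose coefficients are the Tribonacci sequences started at (1,0,0), (0,1,0) and (0,0,1).
-- The left-hand side is therefore a weighted sum of cubes of eight explicit linear forms,
-- i.e. a ternary cubic form in a, b, c, and its ten coefficients all compute to zero.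

IsTribonacci : (ℕ → ℤ) → Set
IsTribonacci x = ∀ n → x (suc (suc (suc n))) ≡ x (suc (suc n)) + x (suc n) + x n

shift-isTribonacci : ∀ {W} → IsGenTribonacci W → ∀ s → IsTribonacci (λ n → W (s + + n))
shift-isTribonacci {W} G s n =
  trans (IsGenTribonacci.recurrence G (s + + suc (suc (suc n))))
        (cong₂ _+_ (cong₂ _+_ (reassoc (+ 1)) (reassoc (+ 2))) (reassoc (+ 3)))
  where
  -- for k = + 1, + 2, + 3 the inner difference + (3 + n) - k reduces to a natural literal
  reassoc : ∀ k → W (s + + suc (suc (suc n)) - k) ≡ W (s + (+ suc (suc (suc n)) - k))
  reassoc k = cong W (+-assoc s (+ suc (suc (suc n))) (- k))

LinearForm : Set
LinearForm = ℤ × ℤ × ℤ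

evalLinear : LinearForm → ℤ → ℤ → ℤ → ℤ
evalLinear (p , q , r) a b c = p * a + q * b + r * c

_⊕_ : LinearForm → LinearForm → LinearForm
(p , q , r) ⊕ (p′ , q′ , r′) = p + p′ , q + q′ , r + r′

evalLinear-⊕ : ∀ u v a b c →
  evalLinear (u ⊕ v) a b c ≡ evalLinear u a b c + evalLinear v a b c
evalLinear-⊕ (p , q , r) (p′ , q′ , r′) = distrib p q r p′ q′ r′
  where
  distrib : ∀ p q r p′ q′ r′ a b c →
    (p + p′) * a + (q + q′) * b + (r + r′) * c ≡ (p * a + q * b + r * c) + (p′ * a + q′ * b + r′ * c)
  distrib = solve-∀

tribonacci : ℤ → ℤ → ℤ → ℕ → ℤ
tribonacci a b c 0 = a
tribonacci a b c 1 = b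
tribonacci a b c 2 = c
tribonacci a b c (suc (suc (suc n))) =
  tribonacci a b c (suc (suc n)) + tribonacci a b c (suc n) + tribonacci a b c n

tribonacciBasis : ℕ → LinearForm
tribonacciBasis n = tribonacci (+ 1) (+ 0) (+ 0) n , tribonacci (+ 0) (+ 1) (+ 0) n , tribonacci (+ 0) (+ 0) (+ 1) n

isTribonacci-basis : ∀ {x} → IsTribonacci x → ∀ n → x n ≡ evalLinear (tribonacciBasis n) (x 0) (x 1) (x 2)
isTribonacci-basis {x} T 0 = unit₁ (x 0) (x 1) (x 2)
  where unit₁ : ∀ a b c → a ≡ + 1 * a + + 0 * b + + 0 * c
        unit₁ = solve-∀
isTribonacci-basis {x} T 1 = unit₂ (x 0) (x 1) (x 2)
  where unit₂ : ∀ a b c → b ≡ + 0 * a + + 1 * b + + 0 * c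
        unit₂ = solve-∀
isTribonacci-basis {x} T 2 = unit₃ (x 0) (x 1) (x 2)
  where unit₃ : ∀ a b c → c ≡ + 0 * a + + 0 * b + + 1 * c
        unit₃ = solve-∀
isTribonacci-basis {x} T (suc (suc (suc n))) = begin
  x (suc (suc (suc n)))                    ≡⟨ T n ⟩
  x (suc (suc n)) + x (suc n) + x n        ≡⟨ cong₂ _+_ (cong₂ _+_ (ih (suc (suc n))) (ih (suc n))) (ih n) ⟩
  ev b₂ + ev b₁ + ev b₀                    ≡⟨ cong (_+ ev b₀) (sym (evalLinear-⊕ b₂ b₁ (x 0) (x 1) (x 2))) ⟩
  ev (b₂ ⊕ b₁) + ev b₀                     ≡⟨ sym (evalLinear-⊕ (b₂ ⊕ b₁) b₀ (x 0) (x 1) (x 2)) ⟩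
  ev (tribonacciBasis (suc (suc (suc n)))) ∎
  where
  ev : LinearForm → ℤ
  ev u = evalLinear u (x 0) (x 1) (x 2)
  b₀ b₁ b₂ : LinearForm
  b₀ = tribonacciBasis n
  b₁ = tribonacciBasis (suc n)
  b₂ = tribonacciBasis (suc (suc n))
  ih : ∀ m → x m ≡ ev (tribonacciBasis m)
  ih = isTribonacci-basis {x} T

dot : ∀ {n} → Vec ℤ n → Vec ℤ n → ℤ
dot [] [] = + 0
dot (u ∷ us) (v ∷ vs) = u * v + dot us vs

dot-zipWith-+ : ∀ {n} (us vs ws : Vec ℤ n) → dot (zipWith _+_ us vs) ws ≡ dot us ws + dot vs ws
dot-zipWith-+ [] [] [] = refl
dot-zipWith-+ (u ∷ us) (v ∷ vs) (w ∷ ws) = begin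
  (u + v) * w + dot (zipWith _+_ us vs) ws   ≡⟨ cong (_+_ ((u + v) * w)) (dot-zipWith-+ us vs ws) ⟩
  (u + v) * w + (dot us ws + dot vs ws)      ≡⟨ interchange u v w (dot us ws) (dot vs ws) ⟩
  u * w + dot us ws + (v * w + dot vs ws)    ∎
  where
  interchange : ∀ u v w s t → (u + v) * w + (s + t) ≡ u * w + s + (v * w + t)
  interchange = solve-∀

dot-map-* : ∀ {n} k (us vs : Vec ℤ n) → dot (Vec.map (k *_) us) vs ≡ k * dot us vs
dot-map-* k [] [] = sym (*-zeroʳ k)
dot-map-* k (u ∷ us) (v ∷ vs) = begin
  k * u * v + dot (Vec.map (k *_) us) vs     ≡⟨ cong (_+_ (k * u * v)) (dot-map-* k us vs) ⟩
  k * u * v + k * dot us vs                  ≡⟨ factor k u v (dot us vs) ⟩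
  k * (u * v + dot us vs)                    ∎
  where
  factor : ∀ k u v s → k * u * v + k * s ≡ k * (u * v + s)
  factor = solve-∀

dot-replicate-0 : ∀ {n} (vs : Vec ℤ n) → dot (replicate n (+ 0)) vs ≡ + 0
dot-replicate-0 [] = refl
dot-replicate-0 (v ∷ vs) = trans (+-identityˡ _) (dot-replicate-0 vs)

Cubic : Set
Cubic = Vec ℤ 10

monomials : ℤ → ℤ → ℤ → Vec ℤ 10
monomials a b c =
  a * a * a ∷ a * a * b ∷ a * a * c ∷ a * b * b ∷ a * b * c ∷
  a * c * c ∷ b * b * b ∷ b * b * c ∷ b * c * c ∷ c * c * c ∷ []

evalCubic : Cubic → ℤ → ℤ → ℤ → ℤ
evalCubic f a b c = dot f (monomials a b c)

cube : LinearForm → Cubic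
cube (p , q , r) =
  p * p * p ∷ + 3 * (p * p * q) ∷ + 3 * (p * p * r) ∷ + 3 * (p * q * q) ∷ + 6 * (p * q * r) ∷
  + 3 * (p * r * r) ∷ q * q * q ∷ + 3 * (q * q * r) ∷ + 3 * (q * r * r) ∷ r * r * r ∷ []

evalCubic-cube : ∀ ℓ a b c → evalCubic (cube ℓ) a b c ≡ evalLinear ℓ a b c * evalLinear ℓ a b c * evalLinear ℓ a b c
evalCubic-cube (p , q , r) a b c = sym (trinomial-cube p q r a b c)
  where
  trinomial-cube : ∀ p q r a b c →
    (p * a + q * b + r * c) * (p * a + q * b + r * c) * (p * a + q * b + r * c) ≡
    p * p * p * (a * a * a) + (+ 3 * (p * p * q) * (a * a * b) + (+ 3 * (p * p * r) * (a * a * c)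
    + (+ 3 * (p * q * q) * (a * b * b) + (+ 6 * (p * q * r) * (a * b * c) + (+ 3 * (p * r * r) * (a * c * c)
    + (q * q * q * (b * b * b) + (+ 3 * (q * q * r) * (b * b * c) + (+ 3 * (q * r * r) * (b * c * c)
    + (r * r * r * (c * c * c) + + 0)))))))))
  trinomial-cube = solve-∀

cubeSum : List (ℤ × ℤ) → ℤ
cubeSum [] = + 0
cubeSum ((k , x) ∷ ts) = k * (x * x * x) + cubeSum ts

cubeSumForm : List (ℤ × LinearForm) → Cubic
cubeSumForm [] = replicate 10 (+ 0)
cubeSumForm ((k , ℓ) ∷ ts) = zipWith _+_ (Vec.map (k *_) (cube ℓ)) (cubeSumForm ts)

evalCubic-cubeSumForm : ∀ ts a b c →
  evalCubic (cubeSumForm ts) a b c ≡ cubeSum (map (map₂ (λ ℓ′ → evalLinear ℓ′ a b c)) ts)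
evalCubic-cubeSumForm [] a b c = dot-replicate-0 (monomials a b c)
evalCubic-cubeSumForm ((k , ℓ) ∷ ts) a b c = begin
  evalCubic (cubeSumForm ((k , ℓ) ∷ ts)) a b c
    ≡⟨ dot-zipWith-+ (Vec.map (k *_) (cube ℓ)) (cubeSumForm ts) (monomials a b c) ⟩
  dot (Vec.map (k *_) (cube ℓ)) (monomials a b c) + evalCubic (cubeSumForm ts) a b c
    ≡⟨ cong₂ _+_ (dot-map-* k (cube ℓ) (monomials a b c)) (evalCubic-cubeSumForm ts a b c) ⟩
  k * evalCubic (cube ℓ) a b c + cubeSum (map (map₂ (λ ℓ′ → evalLinear ℓ′ a b c)) ts)
    ≡⟨ cong (λ y → k * y + _) (evalCubic-cube ℓ a b c) ⟩
  cubeSum (map (map₂ (λ ℓ′ → evalLinear ℓ′ a b c)) ((k , ℓ) ∷ ts)) ∎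

isTribonacci-cubicRelation : ∀ {x} → IsTribonacci x → ∀ ts →
  cubeSumForm (map (map₂ tribonacciBasis) ts) ≡ replicate 10 (+ 0) →
  cubeSum (map (map₂ x) ts) ≡ + 0
isTribonacci-cubicRelation {x} T ts vanishes = begin
  cubeSum (map (map₂ x) ts)
    ≡⟨ cong cubeSum (map-cong (λ (k , n) → cong (k ,_) (isTribonacci-basis {x} T n)) ts) ⟩
  cubeSum (map (map₂ ev ∘ map₂ tribonacciBasis) ts)
    ≡⟨ cong cubeSum (map-∘ ts) ⟩
  cubeSum (map (map₂ ev) (map (map₂ tribonacciBasis) ts))
    ≡⟨ sym (evalCubic-cubeSumForm (map (map₂ tribonacciBasis) ts) (x 0) (x 1) (x 2)) ⟩
  evalCubic (cubeSumForm (map (map₂ tribonacciBasis) ts)) (x 0) (x 1) (x 2)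
    ≡⟨ cong (λ f → evalCubic f (x 0) (x 1) (x 2)) vanishes ⟩
  evalCubic (replicate 10 (+ 0)) (x 0) (x 1) (x 2)
    ≡⟨ dot-replicate-0 (monomials (x 0) (x 1) (x 2)) ⟩
  + 0 ∎
  where
  ev : LinearForm → ℤ
  ev ℓ = evalLinear ℓ (x 0) (x 1) (x 2)

-- (k , n) stands for the term k · W(r − 19 + n)³ of the identity.
relation : List (ℤ × ℕ)
relation =
  (+ 11844 , 19) ∷ (+ 3 , 0) ∷ (+ 1 , 2) ∷ (+ 458556 , 13) ∷ (+ 135548 , 15) ∷
  (- + 442179 , 16) ∷ (- + 120204 , 17) ∷ (- + 43569 , 18) ∷ []

relation-vanishes : cubeSumForm (map (map₂ tribonacciBasis) relation) ≡ replicate 10 (+ 0)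
relation-vanishes = refl

relation-cubeSum : ∀ (x : ℕ → ℤ) {x₀ x₁₉ x₁₇ x₆ x₄ x₃ x₂ x₁} →
  x₀ ≡ x 19 → x₁₉ ≡ x 0 → x₁₇ ≡ x 2 → x₆ ≡ x 13 → x₄ ≡ x 15 → x₃ ≡ x 16 → x₂ ≡ x 17 → x₁ ≡ x 18 →
  + 11844 * (x₀ * x₀ * x₀) + + 3 * (x₁₉ * x₁₉ * x₁₉) + x₁₇ * x₁₇ * x₁₇
    + + 458556 * (x₆ * x₆ * x₆) + + 135548 * (x₄ * x₄ * x₄)
    - + 442179 * (x₃ * x₃ * x₃) - + 120204 * (x₂ * x₂ * x₂) - + 43569 * (x₁ * x₁ * x₁)
  ≡ cubeSum (map (map₂ x) relation)
relation-cubeSum x refl refl refl refl refl refl refl refl =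
  regroup (x³ 19) (x³ 0) (x³ 2) (x³ 13) (x³ 15) (x³ 16) (x³ 17) (x³ 18)
  where
  -- the cubes are regrouped as opaque atoms: normalising the cubic expression itself is far too slow
  x³ : ℕ → ℤ
  x³ n = x n * x n * x n
  regroup : ∀ y₀ y₁₉ y₁₇ y₆ y₄ y₃ y₂ y₁ →
    + 11844 * y₀ + + 3 * y₁₉ + y₁₇ + + 458556 * y₆ + + 135548 * y₄
      - + 442179 * y₃ - + 120204 * y₂ - + 43569 * y₁
    ≡ + 11844 * y₀ + (+ 3 * y₁₉ + (+ 1 * y₁₇ + (+ 458556 * y₆ + (+ 135548 * y₄
      + (- + 442179 * y₃ + (- + 120204 * y₂ + (- + 43569 * y₁ + + 0)))))))
  regroup = solve-∀

theorem9 : (W : ℤ → ℤ) → IsGenTribonacci W → (r : ℤ) →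
    + 11844 * (W r * W r * W r)
    + + 3 * (W (r - + 19) * W (r - + 19) * W (r - + 19))
    + W (r - + 17) * W (r - + 17) * W (r - + 17)
    + + 458556 * (W (r - + 6) * W (r - + 6) * W (r - + 6))
    + + 135548 * (W (r - + 4) * W (r - + 4) * W (r - + 4))
    - + 442179 * (W (r - + 3) * W (r - + 3) * W (r - + 3))
    - + 120204 * (W (r - + 2) * W (r - + 2) * W (r - + 2))
    - + 43569 * (W (r - + 1) * W (r - + 1) * W (r - + 1))
    ≡ + 0
theorem9 W G r =
  trans (relation-cubeSum x e0 e19 e17 e6 e4 e3 e2 e1)
        (isTribonacci-cubicRelation {x} (shift-isTribonacci G (r - + 19)) relation relation-vanishes)
  where
  x : ℕ → ℤ
  x n = W (r - + 19 + + n)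

  reindex : ∀ n → W (r + (- + 19 + + n)) ≡ x n
  reindex n = cong W (sym (+-assoc r (- + 19) (+ n)))

  -- Explicit types keep the arguments of W syntactically those of the statement; left to
  -- inference, Agda would compare them by normalising the integer arithmetic, which is very slow.
  e0 : W r ≡ x 19
  e0 = trans (cong W (sym (+-identityʳ r))) (reindex 19)
  e19 : W (r - + 19) ≡ x 0
  e19 = reindex 0
  e17 : W (r - + 17) ≡ x 2
  e17 = reindex 2
  e6 : W (r - + 6) ≡ x 13
  e6 = reindex 13
  e4 : W (r - + 4) ≡ x 15
  e4 = reindex 15
  e3 : W (r - + 3) ≡ x 16
  e3 = reindex 16
  e2 : W (r - + 2) ≡ x 17
  e2 = reindex 17
  e1 : W (r - + 1) ≡ x 18
  e1 = reindex 18
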